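{- Let $X$ be a pointed totally bounded closeness space, let $Y$ be a closeness space equipped with an approximate linear preorder $(\le^\varepsilon)_{\varepsilon\in\mathbb{N}}$, and let $f:X\to Y$ be uniformly continuous. Then for every precision $\varepsilon\in\mathbb{N}$, $f$ has an $\varepsilon$-global minimum argument, i.e. there is $x_0\in X$ with $f(x_0)\le^\varepsilon f(x)$ for all $x\in X$.
   Context: Constructive type theory; "there is" means an explicit witness. $\mathbb{N}_\infty$: decreasing binary sequences; $\underline{n}$: $n$ ones then zeros; $\infty$: all ones; $u\preceq v$ iff $\forall n\,(u_n=1\Rightarrow v_n=1)$; $\min$ pointwise. A closeness space is a type $X$ with $c:X\to X\to\mathbb{N}_\infty$, $c(x,y)=\infty\iff x=y$, $c$ symmetric, $\min(c(x,y),c(y,z))\preceq c(x,z)$; $C_\varepsilon(x,y)$ means $\underline{\varepsilon}\preceq c(x,y)$. A type is finite linearly ordered if equipped with an equivalence to $\{0,\dots,n-1\}$ for some $n$. An $\varepsilon$-net of $X$ is a finite linearly ordered $X'$ with $g:X'\to X$, $h:X\to X'$ and $C_\varepsilon(x,g(h(x)))$ for all $x$; $X$ is totally bounded if it has an $\varepsilon$-net for each $\varepsilon\in\mathbb{N}$. $f:X\to Y$ between closeness spaces is uniformly continuous if for every $\varepsilon\in\mathbb{N}$ there is $\delta\in\mathbb{N}$ such that $C_\delta(x_1,x_2)\Rightarrow C_\varepsilon(f(x_1),f(x_2))$. An approximate linear preorder on a closeness space $Y$ is a family of proposition-valued relations $\le^\varepsilon$ ($\varepsilon\in\mathbb{N}$)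 such that each $\le^\varepsilon$ is reflexive, transitive, linear (for all $x,y$ we can decide which of $x\le^\varepsilon y$ or $y\le^\varepsilon x$ holds), decidable, and $C_\varepsilon(x,y)\Rightarrow x\le^\varepsilon y$. -}

module Defs where

open import Level using (Level; _⊔_) renaming (suc to lsuc)
open import Data.Nat using (ℕ; zero; suc; _<_)
open import Data.Bool using (Bool; true; false; _∧_)
open import Data.Fin using (Fin)
open import Data.Product using (Σ; _×_; _,_; proj₁; ∃)
open import Data.Sum using (_⊎_)
open import Relation.Nullary using (Dec)
open import Relation.Binary.PropositionalEquality using (_≡_)
open import Function.Bundles using (_↔_; _⇔_)

-- Binary sequences; ℕ∞ = decreasing binary sequences.
-- Equality of sequences is taken pointwise (no function extensionality in --without-K).
isDecreasing : (ℕ → Bool) → Set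
isDecreasing α = ∀ n → α (suc n) ≡ true → α n ≡ true

ℕ∞ : Set
ℕ∞ = Σ (ℕ → Bool) isDecreasing

seq : ℕ∞ → ℕ → Bool
seq = proj₁

_≼_ : ℕ∞ → ℕ∞ → Set
u ≼ v = ∀ n → seq u n ≡ true → seq v n ≡ true

is∞ : ℕ∞ → Set
is∞ u = ∀ n → seq u n ≡ true

_≈∞_ : ℕ∞ → ℕ∞ → Set
u ≈∞ v = ∀ n → seq u n ≡ seq v n

ι-seq : ℕ → ℕ → Bool
ι-seq zero    _       = false
ι-seq (suc n) zero    = true
ι-seq (suc n) (suc k) = ι-seq n k

ι-dec : (n : ℕ) → isDecreasing (ι-seq n)
ι-dec zero    k       ()
ι-dec (suc n) zero    _ = Relation.Binary.PropositionalEquality.refl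
  where import Relation.Binary.PropositionalEquality
ι-dec (suc n) (suc k) p = ι-dec n k p

ι : ℕ → ℕ∞
ι n = ι-seq n , ι-dec n

min∞ : ℕ∞ → ℕ∞ → ℕ∞
min∞ (α , dα) (β , dβ) = (λ n → α n ∧ β n) , d
  where
  d : isDecreasing (λ n → α n ∧ β n)
  d n p with α (suc n) | β (suc n) | dα n | dβ n
  ... | true | true | f | g = aux (f Relation.Binary.PropositionalEquality.refl)
                                  (g Relation.Binary.PropositionalEquality.refl)
    where
    import Relation.Binary.PropositionalEquality
    aux : α n ≡ true → β n ≡ true → (α n ∧ β n) ≡ true
    aux e₁ e₂ rewrite e₁ | e₂ = Relation.Binary.PropositionalEquality.refl
  d n () | true  | false | _ | _
  d n () | false | _     | _ | _

record ClosenessSpace (ℓ : Level) : Set (lsuc ℓ) where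
  field
    Carrier : Set ℓ
    c       : Carrier → Carrier → ℕ∞
    c-∞     : ∀ x y → is∞ (c x y) ⇔ (x ≡ y)
    c-sym   : ∀ x y → c x y ≈∞ c y x
    c-ult   : ∀ x y z → min∞ (c x y) (c y z) ≼ c x z

open ClosenessSpace public

C : ∀ {ℓ} (X : ClosenessSpace ℓ) → ℕ → Carrier X → Carrier X → Set
C X ε x y = ι ε ≼ c X x y

FiniteLinearOrder : ∀ {ℓ} → Set ℓ → Set ℓ
FiniteLinearOrder A = Σ ℕ (λ n → A ↔ Fin n)

record Net {ℓ} (X : ClosenessSpace ℓ) (ε : ℕ) : Set (lsuc ℓ) where
  field
    X'   : Set ℓ
    fin  : FiniteLinearOrder X'
    g    : X' → Carrier X
    h    : Carrier X → X'
    near : ∀ x → C X ε x (g (h x))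

TotallyBounded : ∀ {ℓ} → ClosenessSpace ℓ → Set (lsuc ℓ)
TotallyBounded X = (ε : ℕ) → Net X ε

UniformlyContinuous : ∀ {ℓ ℓ'} (X : ClosenessSpace ℓ) (Y : ClosenessSpace ℓ')
  → (Carrier X → Carrier Y) → Set ℓ
UniformlyContinuous X Y f =
  (ε : ℕ) → Σ ℕ (λ δ → ∀ x₁ x₂ → C X δ x₁ x₂ → C Y ε (f x₁) (f x₂))

isProp : ∀ {a} → Set a → Set a
isProp A = (p q : A) → p ≡ q

record ApproxLinearPreorder {ℓ} (Y : ClosenessSpace ℓ) (r : Level) : Set (ℓ ⊔ lsuc r) where
  field
    _≤[_]_    : Carrier Y → ℕ → Carrier Y → Set r
    ≤-prop    : ∀ ε x y → isProp (x ≤[ ε ] y)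
    ≤-refl    : ∀ ε x → x ≤[ ε ] x
    ≤-trans   : ∀ ε x y z → x ≤[ ε ] y → y ≤[ ε ] z → x ≤[ ε ] z
    ≤-linear  : ∀ ε x y → (x ≤[ ε ] y) ⊎ (y ≤[ ε ] x)
    ≤-dec     : ∀ ε x y → Dec (x ≤[ ε ] y)
    ≤-close   : ∀ ε x y → C Y ε x y → x ≤[ ε ] y

HasGlobalMinimumArg : ∀ {ℓ ℓ' r} (X : ClosenessSpace ℓ) (Y : ClosenessSpace ℓ')
  → ApproxLinearPreorder Y r → ℕ → (Carrier X → Carrier Y) → Set (ℓ ⊔ r)
HasGlobalMinimumArg X Y P ε f =
  Σ (Carrier X) (λ x₀ → ∀ x → f x₀ ≤[ ε ] f x)
  where open ApproxLinearPreorder P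

-- Uniform continuity provides δ such that δ-close points have ε-close, hence
-- ≤ε-comparable, values.  Take a δ-net of X: it is finite and, thanks to the
-- base point, inhabited, so the total preorder x ≼ x′ := f x ≤ε f x′ has a least
-- net point x₀.  Every x is δ-close to its net point g (h x), so
-- f x₀ ≤ε f (g (h x)) ≤ε f x.
module Submission where

open import Defs
open import Level using (Level; _⊔_)
open import Data.Nat using (ℕ; zero; suc)
open import Data.Fin using (Fin; zero; suc)
open import Data.Product using (Σ; _,_; proj₁; proj₂)
open import Data.Sum using (_⊎_; inj₁; inj₂)
open import Function using (_∘_)
open import Function.Bundles using (Inverse)
open import Relation.Binary.PropositionalEquality using (subst; sym; trans)

module FiniteArgmin {a r} {A : Set a} (_≲_ : A → A → Set r)
  (≲-refl : ∀ x → x ≲ x)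
  (≲-trans : ∀ {x y z} → x ≲ y → y ≲ z → x ≲ z)
  (≲-total : ∀ x y → (x ≲ y) ⊎ (y ≲ x))
  where

  IsArgmin : ∀ {b} {B : Set b} → (B → A) → B → Set (b ⊔ r)
  IsArgmin k i = ∀ j → k i ≲ k j

  argmin-Fin : ∀ {n} (k : Fin (suc n) → A) → Σ (Fin (suc n)) (IsArgmin k)
  argmin-Fin {zero} k = zero , λ { zero → ≲-refl (k zero) }
  argmin-Fin {suc n} k with argmin-Fin (k ∘ suc)
  ... | i , kᵢ-min with ≲-total (k zero) (k (suc i))
  ... | inj₁ k₀≲kᵢ = zero , λ { zero → ≲-refl (k zero) ; (suc j) → ≲-trans k₀≲kᵢ (kᵢ-min j) }
  ... | inj₂ kᵢ≲k₀ = suc i , λ { zero → kᵢ≲k₀ ; (suc j) → kᵢ-min j }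

  argmin-finite : ∀ {b} {B : Set b} → FiniteLinearOrder B → B
    → (k : B → A) → Σ B (IsArgmin k)
  argmin-finite (zero , B↔Fin) b k with () ← Inverse.to B↔Fin b
  argmin-finite (suc n , B↔Fin) _ k =
    from i , λ j → subst (λ j′ → k (from i) ≲ k j′) (strictlyInverseʳ j) (kᵢ-min (to j))
    where
    open Inverse B↔Fin
    i-min = argmin-Fin (k ∘ from)
    i = proj₁ i-min
    kᵢ-min = proj₂ i-min

C-sym : ∀ {ℓ} (Y : ClosenessSpace ℓ) ε x y → C Y ε x y → C Y ε y x
C-sym Y ε x y x≈y n ιₙ = trans (sym (c-sym Y x y n)) (x≈y n ιₙ)

theorem4p26 : ∀ {ℓ ℓ' r : Level} (X : ClosenessSpace ℓ) (Y : ClosenessSpace ℓ')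
    → (x* : Carrier X) → TotallyBounded X
    → (P : ApproxLinearPreorder Y r)
    → (f : Carrier X → Carrier Y) → UniformlyContinuous X Y f
    → (ε : ℕ) → HasGlobalMinimumArg X Y P ε f
theorem4p26 X Y x* tb P f uc ε = g i₀ , λ x → ≤-trans ε _ _ _ (i₀-min (h x)) (net-point-below x)
  where
  open ApproxLinearPreorder P
  open FiniteArgmin (λ x x′ → f x ≤[ ε ] f x′) (λ x → ≤-refl ε (f x))
    (≤-trans ε _ _ _) (λ x x′ → ≤-linear ε (f x) (f x′))
  δ = proj₁ (uc ε)
  f-cont = proj₂ (uc ε)
  open Net (tb δ)

  net-point-below : ∀ x → f (g (h x)) ≤[ ε ] f x
  net-point-below x = ≤-close ε _ _ (C-sym Y ε _ _ (f-cont x (g (h x)) (near x)))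

  argmin-net = argmin-finite fin (h x*) g
  i₀ = proj₁ argmin-net
  i₀-min = proj₂ argmin-net
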